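{- Let $n\ge1$ and $P\in\mathcal{P}_n$. Then the number of north steps of $P$ equals $st(\psi(P))$.
   Context: $\mathcal{P}_n$ is the set of self-avoiding lattice paths starting at the origin with unit east, north and south steps, confined to the wedge $-x\le y\le x$, with exactly $n$ east steps and ending at $(n,-n)$. Such a path is determined by the $y$-coordinates $a_1,\dots,a_n$ of its east steps (in order), where $-(i-1)\le a_i\le i-1$. A matching on $[2n]$ is a partition of $\{1,\dots,2n\}$ into $n$ two-element blocks (edges); $\mathcal{M}_n$ is the set of them. The map $\psi:\mathcal{P}_n\to\mathcal{M}_n$ is defined as follows: set $b_i=a_{n+1-i}+n+1-i$ (so $1\le b_i\le 2(n+1-i)-1$); for $i=1,\dots,n$ in this order, connect the leftmost vertex of $[2n]$ not yet connected to the $b_i$-th not-yet-connected vertex to its right. The result is $\psi(P)$. For $M\in\mathcal{M}_n$ with edges $e_1,\dots,e_n$ ordered by increasing left endpoints, and $e_i=(a,b)$, $e_{i+1}=(c,d)$ (with $a<b$, $c<d$), define $st_i(M)=|\{v: d\le v\le b,\ v \text{ is a vertex of some } e_k \text{ with } k>i\}|$ if $e_i,e_{i+1}$ are nested (i.e. $a<c<d<b$), and $st_i(M)=0$ otherwise; put $st(M)=\sum_{i=1}^{n-1}st_i(M)$. -}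

module Defs where

open import Data.Nat as ℕ using (ℕ; zero; suc; _∸_; _<?_; _≟_; _≤?_)
import Data.Nat as N
open import Data.Integer as ℤ using (ℤ; +_; ∣_∣)
open import Data.Fin using (Fin; toℕ)
open import Data.Vec as V using (Vec)
open import Data.List as L using (List; []; _∷_; _++_; length; filter; replicate; upTo)
open import Data.List.Relation.Unary.Any using (any?)
open import Data.Product using (_×_; _,_; proj₁; proj₂)
open import Data.Sum using (_⊎_)
open import Data.Sum.Relation.Unary.All using ()
open import Data.Bool using (if_then_else_)
open import Relation.Nullary using (does; Dec; yes; no)
open import Relation.Binary.PropositionalEquality using (_≡_; refl)
open import Relation.Nullary.Decidable using (_×-dec_; _⊎-dec_)

-- Paths in 𝒫ₙ, encoded (as in the paper) by the y-coordinates
-- a₁,…,aₙ of the east steps (a Vec, index i : Fin n stands for a_{i+1}).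

InP : (n : ℕ) → Vec ℤ n → Set
InP n a = ∀ (i : Fin n) →
  (ℤ.- (+ toℕ i)) ℤ.≤ V.lookup a i × V.lookup a i ℤ.≤ + toℕ i

data Step : Set where
  E N S : Step

vert : ℤ → ℤ → List Step
vert y y' = if does (y ℤ.≤? y') then replicate ∣ y' ℤ.- y ∣ N
                                else replicate ∣ y ℤ.- y' ∣ S

walk : ℤ → List ℤ → ℤ → List Step
walk y []       t = vert y t
walk y (a ∷ as) t = vert y a ++ (E ∷ walk a as t)

pathSteps : (n : ℕ) → Vec ℤ n → List Step
pathSteps n a = walk (+ 0) (V.toList a) (ℤ.- (+ n))

isN : (s : Step) → Dec (s ≡ N)
isN E = no (λ ())
isN N = yes refl
isN S = no (λ ())

northSteps : (n : ℕ) → Vec ℤ n → ℕ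
northSteps n a = length (filter isN (pathSteps n a))

-- Matchings: lists of edges (x , y) with x < y, vertices 1,…,2n.

Edge : Set
Edge = ℕ × ℕ

-- pick the b-th (1-indexed) element of a list and remove it
pick : ℕ → List ℕ → ℕ × List ℕ
pick _             []       = 0 , []
pick zero          (x ∷ xs) = 0 , x ∷ xs
pick (suc zero)    (x ∷ xs) = x , xs
pick (suc (suc k)) (x ∷ xs) with pick (suc k) xs
... | w , r = w , x ∷ r

-- free: not-yet-connected vertices (increasing); bs: the b_i in order
connect : List ℕ → List ℕ → List Edge
connect (v ∷ rs) (b ∷ bs) with pick b rs
... | w , rs' = (v , w) ∷ connect rs' bs
connect _ _ = []

-- b_i = a_{n+1-i} + (n+1-i), i = 1,…,n
bSeq : (n : ℕ) → Vec ℤ n → List ℕ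
bSeq n a = L.reverse (V.toList (V.tabulate (λ (j : Fin n) →
             ∣ V.lookup a j ℤ.+ + suc (toℕ j) ∣)))

psi : (n : ℕ) → Vec ℤ n → List Edge
psi n a = connect (L.map suc (upTo (2 N.* n))) (bSeq n a)

insert : Edge → List Edge → List Edge
insert e [] = e ∷ []
insert e (f ∷ fs) = if does (proj₁ e ≤?  proj₁ f) then e ∷ f ∷ fs else f ∷ insert e fs

sortEdges : List Edge → List Edge
sortEdges = L.foldr insert []

range : ℕ → ℕ → List ℕ
range d b = L.map (d N.+_) (upTo (suc (b ∸ d)))

isVertexOf : (v : ℕ) (es : List Edge) → Dec _
isVertexOf v es = any? (λ e → (v ≟ proj₁ e) ⊎-dec (v ≟ proj₂ e)) es

-- st_i for e_i = (a,b), e_{i+1} = (c,d), later = e_{i+1}, e_{i+2}, …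
stᵢ : Edge → Edge → List Edge → ℕ
stᵢ (a , b) (c , d) later =
  if does ((a <? c) ×-dec ((c <? d) ×-dec (d <? b)))
  then length (filter (λ v → isVertexOf v later) (range d b))
  else 0

stSorted : List Edge → ℕ
stSorted (e ∷ f ∷ rest) = stᵢ e f (f ∷ rest) N.+ stSorted (f ∷ rest)
stSorted _ = 0

st : List Edge → ℕ
st M = stSorted (sortEdges M)

module Submission where

-- Proof idea.  Write c₁,…,cₙ for the shifted heights cᵢ = aᵢ + i of the
-- east steps; they are exactly the numbers bₙ,…,b₁ used by ψ, and the
-- wedge condition says 1 ≤ cᵢ ≤ 2i-1.
--
-- Path side: between the i-th and (i+1)-st east step the path moves
-- vertically from aᵢ to aᵢ₊₁, i.e. it makes cᵢ₊₁ ∸ (cᵢ + 1) north steps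
-- (the final descent to height -n makes none), so the number of north
-- steps is the "ascent sum" Σᵢ (cᵢ₊₁ ∸ (cᵢ + 1)).
--
-- Matching side: running ψ on any increasing list of 2m free vertices,
-- the produced edges already come sorted by left endpoint, and for two
-- consecutive edges produced with choices b and b' the statistic stᵢ
-- equals b ∸ (b' + 1): the edges are nested exactly when b' + 1 < b, and
-- then the later vertices between the two right endpoints are the
-- b ∸ (b' + 1) free vertices lying between them.  Hence st(ψ) is the
-- "descent sum" of b₁,…,bₙ, which is the ascent sum of its reverse.

open import Defs
open import Data.Nat using (ℕ; _≤_)
open import Data.Integer using (ℤ)
open import Data.Vec using (Vec)
open import Relation.Binary.PropositionalEquality using (_≡_)

open import Data.Nat using (zero; suc; _+_; _*_; _∸_; _<_; z≤n; s≤s; _≤?_; _<?_; _≟_)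
import Data.Nat.Properties as ℕₚ
import Data.Integer as ℤ
open import Data.Integer using (+_; -[1+_]; ∣_∣; +≤+)
import Data.Integer.Properties as ℤₚ
open import Data.Integer.Tactic.RingSolver using (solve-∀)
open import Data.Fin using (toℕ) renaming (zero to fzero; suc to fsuc)
import Data.Vec as V
import Data.Vec.Properties as Vₚ
open import Data.List as L using (List; []; _∷_; _++_; length; filter; replicate; upTo)
import Data.List.Properties as Lₚ
open import Data.List.Relation.Unary.All as All using (All; []; _∷_)
import Data.List.Relation.Unary.All.Properties as Allₚ
open import Data.List.Relation.Unary.AllPairs using (AllPairs; []; _∷_)
import Data.List.Relation.Unary.AllPairs.Properties as AllPairsₚ
open import Data.List.Relation.Unary.Any as Any using (Any; here; there)
open import Data.List.Membership.Propositional using (_∈_; _∉_)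
open import Data.List.Membership.Propositional.Properties
  using (∈-++⁺ˡ; ∈-++⁺ʳ; ∈-++⁻; ∈-map⁺; ∈-map⁻; ∈-upTo⁺; ∈-upTo⁻)
open import Data.List.Membership.DecPropositional _≟_ using (_∈?_)
open import Data.Product using (Σ-syntax; _×_; _,_; proj₁; proj₂)
open import Data.Sum using (_⊎_; inj₁; inj₂)
open import Data.Unit using (⊤; tt)
open import Function using (_∘_)
open import Data.Bool using (if_then_else_)
open import Relation.Nullary using (Dec; yes; no; does; ¬_)
open import Relation.Nullary.Decidable using (_×-dec_; dec-true; dec-false)
open import Relation.Unary using (_≐_)
open import Relation.Binary using (tri<; tri≈; tri>)
open import Relation.Binary.PropositionalEquality
  using (refl; sym; trans; cong; cong₂; subst; module ≡-Reasoning)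

InWedge : ℕ → ℤ → Set
InWedge k x = ℤ.- (+ k) ℤ.≤ x × x ℤ.≤ + k

Wedge : ℕ → List ℤ → Set
Wedge k []       = ⊤
Wedge k (x ∷ xs) = InWedge k x × Wedge (suc k) xs

-- The code of a height x at east step k is x + k + 1; for k = i - 1 and
-- x = aᵢ this is the number aᵢ + i from which ψ builds its bⱼ.
code : ℕ → ℤ → ℕ
code k x = ∣ x ℤ.+ + suc k ∣

codes : ℕ → List ℤ → List ℕ
codes k []       = []
codes k (x ∷ xs) = code k x ∷ codes (suc k) xs

shifted-positive : ∀ k x → ℤ.- (+ k) ℤ.≤ x → + 1 ℤ.≤ x ℤ.+ + suc k
shifted-positive k x lo = begin
  + 1                    ≡⟨ sym (cancel (+ k)) ⟩
  ℤ.- (+ k) ℤ.+ + suc k  ≤⟨ ℤₚ.+-monoˡ-≤ (+ suc k) lo ⟩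
  x ℤ.+ + suc k          ∎
  where
  open ℤₚ.≤-Reasoning
  cancel : ∀ K → ℤ.- K ℤ.+ (+ 1 ℤ.+ K) ≡ + 1
  cancel = solve-∀

code-value : ∀ k x → ℤ.- (+ k) ℤ.≤ x → + code k x ≡ x ℤ.+ + suc k
code-value k x lo =
  ℤₚ.0≤i⇒+∣i∣≡i (ℤₚ.≤-trans (+≤+ z≤n) (shifted-positive k x lo))

code-spec : ∀ k x → ℤ.- (+ k) ℤ.≤ x → x ≡ + code k x ℤ.+ -[1+ k ]
code-spec k x lo = begin
  x                                ≡⟨ sym (unshift x (+ suc k)) ⟩
  x ℤ.+ + suc k ℤ.+ ℤ.- (+ suc k)  ≡⟨ cong (ℤ._+ -[1+ k ]) (sym (code-value k x lo)) ⟩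
  + code k x ℤ.+ -[1+ k ]          ∎
  where
  open ≡-Reasoning
  unshift : ∀ y K → y ℤ.+ K ℤ.+ ℤ.- K ≡ y
  unshift = solve-∀

code-bounds : ∀ k x → InWedge k x → 1 ≤ code k x × code k x ≤ suc (2 * k)
code-bounds k x (lo , hi) = lower , upper
  where
  lower : 1 ≤ code k x
  lower = ℤₚ.drop‿+≤+ (subst (+ 1 ℤ.≤_) (sym (code-value k x lo)) (shifted-positive k x lo))
  upper : code k x ≤ suc (2 * k)
  upper = subst (code k x ≤_) width
            (ℤₚ.drop‿+≤+ (subst (ℤ._≤ + (k + suc k)) (sym (code-value k x lo))
                                 (ℤₚ.+-monoˡ-≤ (+ suc k) hi)))
    where
    width : k + suc k ≡ suc (2 * k)
    width = trans (ℕₚ.+-suc k k) (cong (λ m → suc (k + m)) (sym (ℕₚ.+-identityʳ k)))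

code-shift : ∀ c k → + c ℤ.+ -[1+ k ] ≡ + suc c ℤ.+ -[1+ suc k ]
code-shift c k = sym (ℤₚ.[1+m]⊖[1+n]≡m⊖n c (suc k))

lower-wall : ∀ k → ℤ.- (+ k) ≡ + 1 ℤ.+ -[1+ k ]
lower-wall zero    = refl
lower-wall (suc k) = refl

northCount : List Step → ℕ
northCount s = length (filter isN s)

northCount-++ : ∀ s t → northCount (s ++ t) ≡ northCount s + northCount t
northCount-++ s t = trans (cong length (Lₚ.filter-++ isN s t)) (Lₚ.length-++ (filter isN s))

northCount-N : ∀ m → northCount (replicate m N) ≡ m
northCount-N zero    = refl
northCount-N (suc m) = cong suc (northCount-N m)

northCount-S : ∀ m → northCount (replicate m S) ≡ 0
northCount-S zero    = refl
northCount-S (suc m) = northCount-S m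

vert-direction : ∀ y y' {b} → does (y ℤ.≤? y') ≡ b →
  vert y y' ≡ (if b then replicate ∣ y' ℤ.- y ∣ N else replicate ∣ y ℤ.- y' ∣ S)
vert-direction y y' =
  cong (λ b → if b then replicate ∣ y' ℤ.- y ∣ N else replicate ∣ y ℤ.- y' ∣ S)

north-vert : ∀ p q z → northCount (vert (+ p ℤ.+ z) (+ q ℤ.+ z)) ≡ q ∸ p
north-vert p q z with p ≤? q
... | yes p≤q = begin
  northCount (vert y y')                 ≡⟨ cong northCount (vert-direction y y' (dec-true (y ℤ.≤? y') y≤y')) ⟩
  northCount (replicate ∣ y' ℤ.- y ∣ N)  ≡⟨ northCount-N ∣ y' ℤ.- y ∣ ⟩
  ∣ y' ℤ.- y ∣                           ≡⟨ cong ∣_∣ (difference (+ q) (+ p) z) ⟩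
  ∣ + q ℤ.- + p ∣                        ≡⟨ cong ∣_∣ (trans (ℤₚ.m-n≡m⊖n q p) (ℤₚ.⊖-≥ p≤q)) ⟩
  q ∸ p                                  ∎
  where
  open ≡-Reasoning
  y y' : ℤ
  y = + p ℤ.+ z
  y' = + q ℤ.+ z
  y≤y' : y ℤ.≤ y'
  y≤y' = ℤₚ.+-monoˡ-≤ z (+≤+ p≤q)
  difference : ∀ Q P Z → (Q ℤ.+ Z) ℤ.- (P ℤ.+ Z) ≡ Q ℤ.- P
  difference = solve-∀
... | no p≰q = begin
  northCount (vert y y')                 ≡⟨ cong northCount (vert-direction y y' (dec-false (y ℤ.≤? y') y≰y')) ⟩
  northCount (replicate ∣ y ℤ.- y' ∣ S)  ≡⟨ northCount-S ∣ y ℤ.- y' ∣ ⟩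
  0                                      ≡⟨ sym (ℕₚ.m≤n⇒m∸n≡0 (ℕₚ.<⇒≤ q<p)) ⟩
  q ∸ p                                  ∎
  where
  open ≡-Reasoning
  y y' : ℤ
  y = + p ℤ.+ z
  y' = + q ℤ.+ z
  q<p : q < p
  q<p = ℕₚ.≰⇒> p≰q
  y≰y' : ¬ (y ℤ.≤ y')
  y≰y' = ℤₚ.<⇒≱ (ℤₚ.+-monoˡ-< z (ℤ.+<+ q<p))

ascents : ℕ → List ℕ → ℕ
ascents p []       = 0
ascents p (q ∷ qs) = (q ∸ suc p) + ascents q qs

north-walk : ∀ k p xs → Wedge k xs →
  northCount (walk (+ suc p ℤ.+ -[1+ k ]) xs (ℤ.- (+ (k + length xs)))) ≡
  ascents p (codes k xs)
north-walk k p [] _ rewrite ℕₚ.+-identityʳ k =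
  trans (cong (λ t → northCount (vert (+ suc p ℤ.+ -[1+ k ]) t)) (lower-wall k))
        (trans (north-vert (suc p) 1 -[1+ k ]) (ℕₚ.0∸n≡0 p))
north-walk k p (x ∷ xs) ((lo , _) , wedge) rewrite ℕₚ.+-suc k (length xs) = begin
  northCount (vert y x ++ E ∷ walk x xs t)          ≡⟨ northCount-++ (vert y x) (E ∷ walk x xs t) ⟩
  northCount (vert y x) + northCount (walk x xs t)  ≡⟨ cong₂ _+_ first-run rest ⟩
  (q ∸ suc p) + ascents q (codes (suc k) xs)        ∎
  where
  open ≡-Reasoning
  y t : ℤ
  y = + suc p ℤ.+ -[1+ k ]
  t = ℤ.- (+ suc (k + length xs))
  q : ℕ
  q = code k x
  first-run : northCount (vert y x) ≡ q ∸ suc p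
  first-run = trans (cong (λ h → northCount (vert y h)) (code-spec k x lo))
                    (north-vert (suc p) q -[1+ k ])
  rest : northCount (walk x xs t) ≡ ascents q (codes (suc k) xs)
  rest = trans (cong (λ h → northCount (walk h xs t)) (trans (code-spec k x lo) (code-shift q k)))
               (north-walk (suc k) q xs wedge)

Increasing : List ℕ → Set
Increasing = AllPairs _<_

increasing-split : ∀ X {y Z} → Increasing (X ++ y ∷ Z) → All (_< y) X × All (y <_) Z
increasing-split []      (y<Z ∷ _)        = [] , y<Z
increasing-split (x ∷ X) (x<rest ∷ inc) =
  All.lookup x<rest (∈-++⁺ʳ X (here refl)) ∷ proj₁ (increasing-split X inc) ,
  proj₂ (increasing-split X inc)

increasing-prefix : ∀ X {Y} → Increasing (X ++ Y) → Increasing X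
increasing-prefix []      _              = []
increasing-prefix (x ∷ X) (x<rest ∷ inc) = Allₚ.++⁻ˡ X x<rest ∷ increasing-prefix X inc

increasing-remove : ∀ X {y Z} → Increasing (X ++ y ∷ Z) → Increasing (X ++ Z)
increasing-remove []      (_ ∷ inc)      = inc
increasing-remove (x ∷ X) (x<rest ∷ inc) =
  Allₚ.++⁺ (Allₚ.++⁻ˡ X x<rest) (All.tail (Allₚ.++⁻ʳ X x<rest)) ∷ increasing-remove X inc

increasing-map-upTo : ∀ (f : ℕ → ℕ) → (∀ {i j} → i < j → f i < f j) → ∀ n →
  Increasing (L.map f (upTo n))
increasing-map-upTo f mono n =
  subst Increasing (sym (Lₚ.map-upTo f n)) (AllPairsₚ.applyUpTo⁺₁ f n (λ i<j _ → mono i<j))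

∈-skip : ∀ A {w B} {x : ℕ} → x ∈ A ++ B → x ∈ A ++ w ∷ B
∈-skip A x∈ with ∈-++⁻ A x∈
... | inj₁ x∈A = ∈-++⁺ˡ x∈A
... | inj₂ x∈B = ∈-++⁺ʳ A (there x∈B)

split-inside : ∀ A B X {y : ℕ} Z → A ++ B ≡ X ++ y ∷ Z → length X < length A →
  Σ[ Z' ∈ List ℕ ] A ≡ X ++ y ∷ Z' × Z ≡ Z' ++ B
split-inside (a ∷ A) B []      Z eq _ with Lₚ.∷-injective eq
... | refl , refl = A , refl , refl
split-inside (a ∷ A) B (x ∷ X) Z eq (s≤s lt) with Lₚ.∷-injective eq
... | refl , eq' with split-inside A B X Z eq' lt
... | Z' , refl , refl = Z' , refl , refl

split-outside : ∀ A B X {y : ℕ} Z → A ++ B ≡ X ++ y ∷ Z → length A ≤ length X → y ∈ B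
split-outside []      B X       Z refl _        = ∈-++⁺ʳ X (here refl)
split-outside (a ∷ A) B (x ∷ X) Z eq   (s≤s le) = split-outside A B X Z (Lₚ.∷-injectiveʳ eq) le

filter-∈-[] : ∀ zs → filter (_∈? []) zs ≡ []
filter-∈-[] zs = Lₚ.filter-none (_∈? []) (All.universal (λ _ ()) zs)

below-∉ : ∀ {x} zs → All (x <_) zs → x ∉ zs
below-∉ zs x<zs x∈zs = ℕₚ.<-irrefl refl (All.lookup x<zs x∈zs)

filter-∈-∷ : ∀ {x} xs zs → x ∉ zs → filter (_∈? x ∷ xs) zs ≡ filter (_∈? xs) zs
filter-∈-∷         xs []       _  = refl
filter-∈-∷ {x = x} xs (z ∷ zs) x∉ = by-cases (z ∈? xs)
  where
  ih : filter (_∈? x ∷ xs) zs ≡ filter (_∈? xs) zs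
  ih = filter-∈-∷ xs zs (x∉ ∘ there)
  by-cases : Dec (z ∈ xs) → filter (_∈? x ∷ xs) (z ∷ zs) ≡ filter (_∈? xs) (z ∷ zs)
  by-cases (yes z∈) = trans (Lₚ.filter-accept (_∈? x ∷ xs) (there z∈))
                     (trans (cong (z ∷_) ih) (sym (Lₚ.filter-accept (_∈? xs) z∈)))
  by-cases (no z∉)  = trans (Lₚ.filter-reject (_∈? x ∷ xs) z∉x∷xs)
                     (trans ih (sym (Lₚ.filter-reject (_∈? xs) z∉)))
    where
    z∉x∷xs : z ∉ x ∷ xs
    z∉x∷xs (here z≡x)  = x∉ (here (sym z≡x))
    z∉x∷xs (there z∈) = z∉ z∈

common-count-sym : ∀ xs ys → Increasing xs → Increasing ys →
  length (filter (_∈? ys) xs) ≡ length (filter (_∈? xs) ys)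
common-count-sym []       ys _              _  = cong length (sym (filter-∈-[] ys))
common-count-sym (x ∷ xs) ys (x<xs ∷ incx) iy = against ys iy
  where
  open ≡-Reasoning
  against : ∀ ys → Increasing ys →
    length (filter (_∈? ys) (x ∷ xs)) ≡ length (filter (_∈? x ∷ xs) ys)
  against []       _              = cong length (filter-∈-[] (x ∷ xs))
  against (y ∷ ys) (y<ys ∷ incy) with ℕₚ.<-cmp x y
  ... | tri< x<y _ _ = begin
    length (filter (_∈? y ∷ ys) (x ∷ xs))  ≡⟨ cong length (Lₚ.filter-reject (_∈? y ∷ ys) x∉) ⟩
    length (filter (_∈? y ∷ ys) xs)        ≡⟨ common-count-sym xs (y ∷ ys) incx (y<ys ∷ incy) ⟩
    length (filter (_∈? xs) (y ∷ ys))      ≡⟨ cong length (sym (filter-∈-∷ xs (y ∷ ys) x∉)) ⟩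
    length (filter (_∈? x ∷ xs) (y ∷ ys))  ∎
    where
    x∉ : x ∉ y ∷ ys
    x∉ = below-∉ (y ∷ ys) (x<y ∷ All.map (ℕₚ.<-trans x<y) y<ys)
  ... | tri≈ _ refl _ = begin
    length (filter (_∈? x ∷ ys) (x ∷ xs))  ≡⟨ cong length (Lₚ.filter-accept (_∈? x ∷ ys) (here refl)) ⟩
    suc (length (filter (_∈? x ∷ ys) xs))  ≡⟨ cong (suc ∘ length) (filter-∈-∷ ys xs (below-∉ xs x<xs)) ⟩
    suc (length (filter (_∈? ys) xs))      ≡⟨ cong suc (common-count-sym xs ys incx incy) ⟩
    suc (length (filter (_∈? xs) ys))      ≡⟨ cong (suc ∘ length) (sym (filter-∈-∷ xs ys (below-∉ ys y<ys))) ⟩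
    suc (length (filter (_∈? x ∷ xs) ys))  ≡⟨ cong length (sym (Lₚ.filter-accept (_∈? x ∷ xs) (here refl))) ⟩
    length (filter (_∈? x ∷ xs) (x ∷ ys))  ∎
  ... | tri> _ _ y<x = begin
    length (filter (_∈? y ∷ ys) (x ∷ xs))  ≡⟨ cong length (filter-∈-∷ ys (x ∷ xs) y∉) ⟩
    length (filter (_∈? ys) (x ∷ xs))      ≡⟨ against ys incy ⟩
    length (filter (_∈? x ∷ xs) ys)        ≡⟨ cong length (sym (Lₚ.filter-reject (_∈? x ∷ xs) y∉)) ⟩
    length (filter (_∈? x ∷ xs) (y ∷ ys))  ∎
    where
    y∉ : y ∉ x ∷ xs
    y∉ = below-∉ (x ∷ xs) (y<x ∷ All.map (ℕₚ.<-trans y<x) x<xs)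

Between : ℕ → ℕ → ℕ → Set
Between d b x = d ≤ x × x ≤ b

between? : ∀ d b x → Dec (Between d b x)
between? d b x = (d ≤? x) ×-dec (x ≤? b)

∈-range : ∀ {d b} → d ≤ b → (_∈ range d b) ≐ Between d b
∈-range {d} {b} d≤b = inside , listed
  where
  inside : ∀ {x} → x ∈ range d b → Between d b x
  inside x∈ with ∈-map⁻ (λ i → d + i) x∈
  ... | i , i∈ , refl = ℕₚ.m≤m+n d i ,
    subst (d + i ≤_) (ℕₚ.m+[n∸m]≡n d≤b) (ℕₚ.+-monoʳ-≤ d (ℕₚ.≤-pred (∈-upTo⁻ i∈)))
  listed : ∀ {x} → Between d b x → x ∈ range d b
  listed {x} (d≤x , x≤b) = subst (_∈ range d b) (ℕₚ.m+[n∸m]≡n d≤x)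
    (∈-map⁺ (λ i → d + i) (∈-upTo⁺ (s≤s (ℕₚ.∸-monoˡ-≤ d x≤b))))

count-range : ∀ {d b} L → d ≤ b → Increasing L →
  length (filter (_∈? L) (range d b)) ≡ length (filter (between? d b) L)
count-range {d} {b} L d≤b inc = trans
  (common-count-sym (range d b) L (increasing-map-upTo (λ i → d + i) (ℕₚ.+-monoʳ-< d) (suc (b ∸ d))) inc)
  (cong length (Lₚ.filter-≐ (_∈? range d b) (between? d b) (∈-range d≤b) L))

filter-window : ∀ {d b} X Y Z → All (_< d) X → All (Between d b) Y → All (b <_) Z →
  filter (between? d b) (X ++ Y ++ Z) ≡ Y
filter-window {d} {b} X Y Z below inside above = begin
  filter (between? d b) (X ++ Y ++ Z)                          ≡⟨ Lₚ.filter-++ (between? d b) X (Y ++ Z) ⟩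
  filter (between? d b) X ++ filter (between? d b) (Y ++ Z)    ≡⟨ cong₂ _++_ (Lₚ.filter-none (between? d b) outside-below)
                                                                              (Lₚ.filter-++ (between? d b) Y Z) ⟩
  filter (between? d b) Y ++ filter (between? d b) Z          ≡⟨ cong₂ _++_ (Lₚ.filter-all (between? d b) inside)
                                                                              (Lₚ.filter-none (between? d b) outside-above) ⟩
  Y ++ []                                                      ≡⟨ Lₚ.++-identityʳ Y ⟩
  Y                                                            ∎
  where
  open ≡-Reasoning
  outside-below : All (¬_ ∘ Between d b) X
  outside-below = All.map (λ x<d (d≤x , _) → ℕₚ.<⇒≱ x<d d≤x) below
  outside-above : All (¬_ ∘ Between d b) Z
  outside-above = All.map (λ b<x (_ , x≤b) → ℕₚ.<⇒≱ b<x x≤b) above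

IsVertex : ℕ → List Edge → Set
IsVertex x es = Any (λ e → x ≡ proj₁ e ⊎ x ≡ proj₂ e) es

-- Choice sequences valid for ψ: a choice b followed by m further choices
-- is made among the 2m + 1 free vertices right of the leftmost one.
Admissible : List ℕ → Set
Admissible []       = ⊤
Admissible (b ∷ bs) = (1 ≤ b × b ≤ suc (2 * length bs)) × Admissible bs

record Picked (b : ℕ) (xs : List ℕ) : Set where
  constructor picked
  field
    before : List ℕ
    chosen : ℕ
    after  : List ℕ
    splits : xs ≡ before ++ chosen ∷ after
    result : pick b xs ≡ (chosen , before ++ after)
    place  : suc (length before) ≡ b

pick-spec : ∀ b xs → 1 ≤ b → b ≤ length xs → Picked b xs
pick-spec (suc zero)    (x ∷ xs) _ _         = picked [] x xs refl refl refl
pick-spec (suc (suc b)) (x ∷ xs) _ (s≤s b<) with pick-spec (suc b) xs (s≤s z≤n) b<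
... | picked A w B refl res pl =
  picked (x ∷ A) w B refl (cong (λ r → proj₁ r , x ∷ proj₂ r) res) (cong suc pl)

record Round (v : ℕ) (rs : List ℕ) (b : ℕ) (bs : List ℕ) : Set where
  constructor round
  field
    before    : List ℕ
    partner   : ℕ
    after     : List ℕ
    splits    : rs ≡ before ++ partner ∷ after
    place     : suc (length before) ≡ b
    unfolds   : connect (v ∷ rs) (b ∷ bs) ≡ (v , partner) ∷ connect (before ++ after) bs
    remaining : length (before ++ after) ≡ 2 * length bs

odd-rest : ∀ (xs : List ℕ) m → suc (length xs) ≡ 2 * suc m → length xs ≡ suc (2 * m)
odd-rest xs m eq = trans (ℕₚ.suc-injective eq) (ℕₚ.+-suc m (m + 0))

connect-round : ∀ v rs b bs → length (v ∷ rs) ≡ 2 * length (b ∷ bs) → Admissible (b ∷ bs) →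
  Round v rs b bs
connect-round v rs b bs len ((1≤b , b≤) , _)
  with pick-spec b rs 1≤b (subst (b ≤_) (sym (odd-rest rs (length bs) len)) b≤)
... | picked A w B refl res pl =
  round A w B refl pl (cong (λ r → (v , proj₁ r) ∷ connect (proj₂ r) bs) res)
    (ℕₚ.suc-injective (trans (sym (Lₚ.length-++-sucʳ A w B)) (odd-rest (A ++ w ∷ B) (length bs) len)))

vertices-connect : ∀ F bs → length F ≡ 2 * length bs → Admissible bs →
  (λ x → IsVertex x (connect F bs)) ≐ (_∈ F)
vertices-connect []       []       _  _   = (λ ()) , (λ ())
vertices-connect (v ∷ rs) (b ∷ bs) len adm with connect-round v rs b bs len adm
... | round A w B refl _ unfolds remaining =
  subst (λ es → (λ x → IsVertex x es) ≐ (_∈ v ∷ A ++ w ∷ B)) (sym unfolds) (to , from)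
  where
  ih : (λ x → IsVertex x (connect (A ++ B) bs)) ≐ (_∈ A ++ B)
  ih = vertices-connect (A ++ B) bs remaining (proj₂ adm)
  to : ∀ {x} → IsVertex x ((v , w) ∷ connect (A ++ B) bs) → x ∈ v ∷ A ++ w ∷ B
  to (here (inj₁ refl)) = here refl
  to (here (inj₂ refl)) = there (∈-++⁺ʳ A (here refl))
  to (there x∈)         = there (∈-skip A (proj₁ ih x∈))
  from : ∀ {x} → x ∈ v ∷ A ++ w ∷ B → IsVertex x ((v , w) ∷ connect (A ++ B) bs)
  from (here refl) = here (inj₁ refl)
  from (there x∈) with ∈-++⁻ A x∈
  ... | inj₁ x∈A         = there (proj₂ ih (∈-++⁺ˡ x∈A))
  ... | inj₂ (here refl) = here (inj₂ refl)
  ... | inj₂ (there x∈B) = there (proj₂ ih (∈-++⁺ʳ A x∈B))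

insert-front : ∀ e es → All (λ f → proj₁ e ≤ proj₁ f) es → insert e es ≡ e ∷ es
insert-front e []       _         = refl
insert-front e (f ∷ fs) (e≤f ∷ _) =
  cong (λ c → if c then e ∷ f ∷ fs else f ∷ insert e fs) (dec-true (proj₁ e ≤? proj₁ f) e≤f)

sortEdges-connect : ∀ F bs → Increasing F → length F ≡ 2 * length bs → Admissible bs →
  sortEdges (connect F bs) ≡ connect F bs
sortEdges-connect []       []       _              _   _   = refl
sortEdges-connect (v ∷ rs) (b ∷ bs) (v<rs ∷ inc) len adm with connect-round v rs b bs len adm
... | round A w B refl _ unfolds remaining = begin
  sortEdges (connect (v ∷ A ++ w ∷ B) (b ∷ bs))  ≡⟨ cong sortEdges unfolds ⟩
  insert (v , w) (sortEdges rest)                ≡⟨ cong (insert (v , w)) sorted-rest ⟩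
  insert (v , w) rest                            ≡⟨ insert-front (v , w) rest v-first ⟩
  (v , w) ∷ rest                                 ≡⟨ sym unfolds ⟩
  connect (v ∷ A ++ w ∷ B) (b ∷ bs)              ∎
  where
  open ≡-Reasoning
  rest : List Edge
  rest = connect (A ++ B) bs
  sorted-rest : sortEdges rest ≡ rest
  sorted-rest = sortEdges-connect (A ++ B) bs (increasing-remove A inc) remaining (proj₂ adm)
  v-first : All (λ f → v ≤ proj₁ f) rest
  v-first = All.tabulate λ f∈ → ℕₚ.<⇒≤ (All.lookup v<rs (∈-skip A
    (proj₁ (vertices-connect (A ++ B) bs remaining (proj₂ adm)) (Any.map (λ { refl → inj₁ refl }) f∈))))

st-nested : ∀ v u C w' D' w B (later : List Edge) →
  Increasing (v ∷ (u ∷ C ++ w' ∷ D') ++ w ∷ B) →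
  (λ x → IsVertex x later) ≐ (_∈ u ∷ C ++ w' ∷ D' ++ B) →
  stᵢ (v , w) (u , w') later ≡ suc (length D')
st-nested v u C w' D' w B later (v<F ∷ inc) vertices = begin
  stᵢ (v , w) (u , w') later
    ≡⟨ cong (λ c → if c then count else 0)
            (dec-true ((v <? u) ×-dec ((u <? w') ×-dec (w' <? w))) (v<u , u<w' , w'<w)) ⟩
  count
    ≡⟨ cong length (Lₚ.filter-≐ (λ x → isVertexOf x later) (_∈? R) vertices (range w' w)) ⟩
  length (filter (_∈? R) (range w' w))
    ≡⟨ count-range R (ℕₚ.<⇒≤ w'<w) increasing-R ⟩
  length (filter (between? w' w) R)
    ≡⟨ cong length (filter-window (u ∷ C) (w' ∷ D') B (proj₁ around-w') window (proj₂ around-w)) ⟩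
  suc (length D')  ∎
  where
  open ≡-Reasoning
  A R : List ℕ
  A = u ∷ C ++ w' ∷ D'
  R = u ∷ C ++ w' ∷ D' ++ B
  count : ℕ
  count = length (filter (λ x → isVertexOf x later) (range w' w))
  around-w : All (_< w) A × All (w <_) B
  around-w = increasing-split A inc
  around-w' : All (_< w') (u ∷ C) × All (w' <_) D'
  around-w' = increasing-split (u ∷ C) (increasing-prefix A inc)
  increasing-R : Increasing R
  increasing-R = subst Increasing (Lₚ.++-assoc (u ∷ C) (w' ∷ D') B) (increasing-remove A inc)
  v<u : v < u
  v<u = All.head v<F
  u<w' : u < w'
  u<w' = All.head (proj₁ around-w')
  w'D'<w : All (_< w) (w' ∷ D')
  w'D'<w = Allₚ.++⁻ʳ (u ∷ C) (proj₁ around-w)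
  w'<w : w' < w
  w'<w = All.head w'D'<w
  window : All (Between w' w) (w' ∷ D')
  window = (ℕₚ.≤-refl , ℕₚ.<⇒≤ w'<w) ∷
           All.zipWith (λ (w'<d , d<w) → ℕₚ.<⇒≤ w'<d , ℕₚ.<⇒≤ d<w) (proj₂ around-w' , All.tail w'D'<w)

st-apart : ∀ v w u w' B (later : List Edge) → All (w <_) B → w' ∈ B →
  stᵢ (v , w) (u , w') later ≡ 0
st-apart v w u w' B later w<B w'∈B =
  cong (λ c → if c then length (filter (λ x → isVertexOf x later) (range w' w)) else 0)
       (dec-false ((v <? u) ×-dec ((u <? w') ×-dec (w' <? w)))
                  (λ (_ , _ , w'<w) → ℕₚ.<-asym w'<w (All.lookup w<B w'∈B)))

st-local : ∀ v A w B u C w' D (later : List Edge) →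
  Increasing (v ∷ A ++ w ∷ B) → A ++ B ≡ u ∷ C ++ w' ∷ D →
  (λ x → IsVertex x later) ≐ (_∈ u ∷ C ++ w' ∷ D) →
  stᵢ (v , w) (u , w') later ≡ length A ∸ suc (length C)
st-local v A w B u C w' D later inc eq vertices with suc (length C) <? length A
... | yes inner with split-inside A B (u ∷ C) D eq inner
...   | D' , refl , refl =
  trans (st-nested v u C w' D' w B later inc vertices) (sym positions)
  where
  positions : length (u ∷ C ++ w' ∷ D') ∸ suc (length C) ≡ suc (length D')
  positions = trans (cong (_∸ length C) (Lₚ.length-++ C)) (ℕₚ.m+n∸m≡n (length C) (suc (length D')))
st-local v A w B u C w' D later (_ ∷ inc) eq vertices | no outer =
  trans (st-apart v w u w' B later (proj₂ (increasing-split A inc))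
                  (split-outside A B (u ∷ C) D eq (ℕₚ.≮⇒≥ outer)))
        (sym (ℕₚ.m≤n⇒m∸n≡0 (ℕₚ.≮⇒≥ outer)))

gap : ℕ → List ℕ → ℕ
gap b []       = 0
gap b (b' ∷ _) = b ∸ suc b'

descents : List ℕ → ℕ
descents []       = 0
descents (b ∷ bs) = gap b bs + descents bs

stSorted-first : ∀ v A w B R bs → Increasing (v ∷ A ++ w ∷ B) → A ++ B ≡ R →
  length R ≡ 2 * length bs → Admissible bs →
  stSorted ((v , w) ∷ connect R bs) ≡ gap (suc (length A)) bs + stSorted (connect R bs)
stSorted-first v A w B []      []       _   _  _   _   = refl
stSorted-first v A w B (u ∷ r) []       _   _  _   _   = refl
stSorted-first v A w B (u ∷ r) (b ∷ bs) inc eq len adm with connect-round u r b bs len adm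
... | round C w' D refl refl unfolds remaining = begin
  stSorted ((v , w) ∷ connect R (b ∷ bs))
    ≡⟨ cong (λ es → stSorted ((v , w) ∷ es)) unfolds ⟩
  stᵢ (v , w) (u , w') next + stSorted next
    ≡⟨ cong (_+ stSorted next) (st-local v A w B u C w' D next inc eq vertices) ⟩
  (length A ∸ suc (length C)) + stSorted next
    ≡⟨ cong (λ es → (length A ∸ suc (length C)) + stSorted es) (sym unfolds) ⟩
  gap (suc (length A)) (b ∷ bs) + stSorted (connect R (b ∷ bs))  ∎
  where
  open ≡-Reasoning
  R : List ℕ
  R = u ∷ C ++ w' ∷ D
  next : List Edge
  next = (u , w') ∷ connect (C ++ D) bs
  vertices : (λ x → IsVertex x next) ≐ (_∈ R)
  vertices = subst (λ es → (λ x → IsVertex x es) ≐ (_∈ R)) unfolds (vertices-connect R (b ∷ bs) len adm)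

stSorted-connect : ∀ F bs → Increasing F → length F ≡ 2 * length bs → Admissible bs →
  stSorted (connect F bs) ≡ descents bs
stSorted-connect []       []       _   _   _   = refl
stSorted-connect (v ∷ rs) (b ∷ bs) inc@(_ ∷ inc-rs) len adm with connect-round v rs b bs len adm
... | round A w B refl refl unfolds remaining = begin
  stSorted (connect (v ∷ A ++ w ∷ B) (suc (length A) ∷ bs))
    ≡⟨ cong stSorted unfolds ⟩
  stSorted ((v , w) ∷ connect (A ++ B) bs)
    ≡⟨ stSorted-first v A w B (A ++ B) bs inc refl remaining (proj₂ adm) ⟩
  gap (suc (length A)) bs + stSorted (connect (A ++ B) bs)
    ≡⟨ cong (λ s → gap (suc (length A)) bs + s) ih ⟩
  descents (suc (length A) ∷ bs)  ∎
  where
  open ≡-Reasoning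
  ih : stSorted (connect (A ++ B) bs) ≡ descents bs
  ih = stSorted-connect (A ++ B) bs (increasing-remove A inc-rs) remaining (proj₂ adm)

st-connect : ∀ F bs → Increasing F → length F ≡ 2 * length bs → Admissible bs →
  st (connect F bs) ≡ descents bs
st-connect F bs inc len adm =
  trans (cong stSorted (sortEdges-connect F bs inc len adm)) (stSorted-connect F bs inc len adm)

descents-reverseAcc : ∀ p acc qs →
  descents (L.reverseAcc (p ∷ acc) qs) ≡ ascents p qs + descents (p ∷ acc)
descents-reverseAcc p acc []       = refl
descents-reverseAcc p acc (q ∷ qs) = begin
  descents (L.reverseAcc (q ∷ p ∷ acc) qs)             ≡⟨ descents-reverseAcc q (p ∷ acc) qs ⟩
  ascents q qs + ((q ∸ suc p) + descents (p ∷ acc))    ≡⟨ sym (ℕₚ.+-assoc (ascents q qs) (q ∸ suc p) _) ⟩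
  (ascents q qs + (q ∸ suc p)) + descents (p ∷ acc)
    ≡⟨ cong (_+ descents (p ∷ acc)) (ℕₚ.+-comm (ascents q qs) (q ∸ suc p)) ⟩
  ascents p (q ∷ qs) + descents (p ∷ acc)              ∎
  where open ≡-Reasoning

descents-reverse : ∀ p qs → descents (L.reverse (p ∷ qs)) ≡ ascents p qs
descents-reverse p qs = trans (descents-reverseAcc p [] qs) (ℕₚ.+-identityʳ (ascents p qs))

admissible-reverse : ∀ acc xs → Admissible acc → Wedge (length acc) xs →
  Admissible (L.reverseAcc acc (codes (length acc) xs))
admissible-reverse acc []       adm _                  = adm
admissible-reverse acc (x ∷ xs) adm (in-wedge , wedge) =
  admissible-reverse (code (length acc) x ∷ acc) xs (code-bounds (length acc) x in-wedge , adm) wedge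

length-codes : ∀ k xs → length (codes k xs) ≡ length xs
length-codes k []       = refl
length-codes k (x ∷ xs) = cong suc (length-codes (suc k) xs)

tabulate-codes : ∀ {m} k (a : Vec ℤ m) →
  V.toList (V.tabulate (λ j → code (k + toℕ j) (V.lookup a j))) ≡ codes k (V.toList a)
tabulate-codes k V.[]       = refl
tabulate-codes k (x V.∷ a) = cong₂ _∷_ (cong (λ i → code i x) (ℕₚ.+-identityʳ k))
  (trans (cong V.toList (Vₚ.tabulate-cong (λ j → cong (λ i → code i (V.lookup a j)) (ℕₚ.+-suc k (toℕ j)))))
         (tabulate-codes (suc k) a))

wedge-toList : ∀ {m} k (a : Vec ℤ m) → (∀ i → InWedge (k + toℕ i) (V.lookup a i)) →
  Wedge k (V.toList a)
wedge-toList k V.[]       _        = tt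
wedge-toList k (x V.∷ a) in-wedge =
  subst (λ i → InWedge i x) (ℕₚ.+-identityʳ k) (in-wedge fzero) ,
  wedge-toList (suc k) a (λ i → subst (λ j → InWedge j (V.lookup a i)) (ℕₚ.+-suc k (toℕ i)) (in-wedge (fsuc i)))

north-path : ∀ n (a : Vec ℤ n) → Wedge 0 (V.toList a) →
  northSteps n a ≡ ascents 0 (codes 0 (V.toList a))
north-path n a wedge =
  subst (λ m → northCount (walk (+ 0) (V.toList a) (ℤ.- (+ m))) ≡ ascents 0 (codes 0 (V.toList a)))
        (Vₚ.length-toList a) (north-walk 0 0 (V.toList a) wedge)

st-psi : ∀ n (a : Vec ℤ n) → Wedge 0 (V.toList a) →
  st (psi n a) ≡ descents (L.reverse (codes 0 (V.toList a)))
st-psi n a wedge = trans (cong (λ bs → st (connect F bs)) (cong L.reverse (tabulate-codes 0 a)))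
  (st-connect F bs (increasing-map-upTo suc s≤s (2 * n)) lengths (admissible-reverse [] (V.toList a) tt wedge))
  where
  F bs : List ℕ
  F = L.map suc (upTo (2 * n))
  bs = L.reverse (codes 0 (V.toList a))
  lengths : length F ≡ 2 * length bs
  lengths = begin
    length F                          ≡⟨ Lₚ.length-map suc (upTo (2 * n)) ⟩
    length (upTo (2 * n))             ≡⟨ Lₚ.length-upTo (2 * n) ⟩
    2 * n                             ≡⟨ cong (2 *_) (sym (Vₚ.length-toList a)) ⟩
    2 * length (V.toList a)           ≡⟨ cong (2 *_) (sym (length-codes 0 (V.toList a))) ⟩
    2 * length (codes 0 (V.toList a)) ≡⟨ cong (2 *_) (sym (Lₚ.length-reverse (codes 0 (V.toList a)))) ⟩
    2 * length bs                     ∎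
    where open ≡-Reasoning

lemma1 : (n : ℕ) → 1 ≤ n → (a : Vec ℤ n) → InP n a →
           northSteps n a ≡ st (psi n a)
lemma1 (suc m) _ a@(x V.∷ a') in-p = begin
  northSteps (suc m) a                     ≡⟨ north-path (suc m) a wedge ⟩
  (c ∸ 1) + ascents c cs                   ≡⟨ cong (_+ ascents c cs) first-rise ⟩
  ascents c cs                             ≡⟨ sym (descents-reverse c cs) ⟩
  descents (L.reverse (c ∷ cs))            ≡⟨ sym (st-psi (suc m) a wedge) ⟩
  st (psi (suc m) a)                       ∎
  where
  open ≡-Reasoning
  wedge : Wedge 0 (V.toList a)
  wedge = wedge-toList 0 a in-p
  c : ℕ
  c = code 0 x
  cs : List ℕ
  cs = codes 1 (V.toList a')
  -- the wedge forces a₁ = 0, so c₁ = 1 and the rise from the start vanishes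
  first-rise : c ∸ 1 ≡ 0
  first-rise = ℕₚ.m≤n⇒m∸n≡0 (proj₂ (code-bounds 0 x (proj₁ wedge)))
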